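{- Let $c\in\mathrm{Rec}_n$ and let $c'$ be the configuration obtained from $c$ by applying a single iteration (Steps (1) and (2)) of the reduction algorithm. Let $p=(n-c_1,\dots,n-c_n)$ and $p'=(n-c'_1,\dots,n-c'_n)$. Then $\mathcal{O}_{\mathrm{MVP}_n}(p')=\mathcal{O}_{\mathrm{MVP}_n}(p)$.
   Context: Abelian sandpile model on $K_n$: a configuration is $c\in\mathbb{Z}_{\ge0}^n$; vertex $i$ is stable if $c_i<n$. Toppling an unstable vertex $i$ subtracts $n$ from $c_i$ and adds $1$ to every other $c_j$. Fix a distribution $\mu$ on $[n]$ with all $\mu_i>0$; the Markov chain on stable configurations adds a grain at $i$ with probability $\mu_i$ and stabilises. $\mathrm{Rec}_n$ is its set of recurrent configurations (equivalently, stable $c$ such that $(n-c_1,\dots,n-c_n)$ is a parking function). Reduction algorithm iteration on $c$: (1) if the entries of $c$ are pairwise distinct, return $c$ (stop); otherwise let $j=\min\{j': c_{j'}\in\{c_1,\dots,c_{j'-1}\}\}$ and $i<j$ the index with $c_i=c_j$; (2) while some $j'\in\{1,\dots,j\}\setminus\{i\}$ has $c_{j'}=c_i$, decrease $c_i$ by one. MVP parking process for $p\in[n]^n$: cars $1,\dots,n$ enter in order a one-way street with spots $1,\dots,n$; car $i$ parks in spot $p_i$, and if $p_i$ was occupied by an earlier car $j$, car $j$ is bumped and parks in the first unoccupied spot $k>p_i$ (bumped cars do not bump others). The outcome $\mathcal{O}_{\mathrm{MVP}_n}(p)$ (when all cars park) is the permutation $\pi$ with $\pi_i$ the car in spot $i$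 at the end. -}

module Defs where

open import Data.Nat using (ℕ; zero; suc; _∸_; _≤_; _<_; _≡ᵇ_; _≤?_)
open import Data.Bool using (Bool; true; false; _∨_; if_then_else_)
open import Data.List using (List; []; _∷_; _++_; length; filter; map; take; replicate)
open import Data.Maybe using (Maybe; just; nothing)
open import Data.Product using (_×_; _,_)
open import Data.Vec using (Vec; toList)
open import Data.List.Relation.Unary.All using (All)

-- Configurations on K_n are vectors c : Vec ℕ n (vertex i ↦ c_i).
-- Internally all list indices below are 0-based.

IsParkingFunction : (n : ℕ) → List ℕ → Set
IsParkingFunction n p =
  (k : ℕ) → 1 ≤ k → k ≤ n → k ≤ length (filter (_≤? k) p)

toPref : (n : ℕ) → List ℕ → List ℕ
toPref n c = map (n ∸_) c

Rec : (n : ℕ) → Vec ℕ n → Set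
Rec n c = All (_< n) (toList c) × IsParkingFunction n (toPref n (toList c))

elem : ℕ → List ℕ → Bool
elem v [] = false
elem v (x ∷ xs) = (v ≡ᵇ x) ∨ elem v xs

indexOf : ℕ → List ℕ → ℕ
indexOf v [] = zero
indexOf v (x ∷ xs) = if v ≡ᵇ x then zero else suc (indexOf v xs)

-- scan c with the list of already-seen entries (in order) and the current index;
-- returns (i , j) with j the least index whose entry occurs earlier, and i < j the
-- index of that earlier occurrence
findRep : List ℕ → ℕ → List ℕ → Maybe (ℕ × ℕ)
findRep seen k [] = nothing
findRep seen k (x ∷ xs) =
  if elem x seen then just (indexOf x seen , k)
  else findRep (seen ++ (x ∷ [])) (suc k) xs

firstRepeat : List ℕ → Maybe (ℕ × ℕ)
firstRepeat c = findRep [] zero c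

removeAt : ℕ → List ℕ → List ℕ
removeAt i [] = []
removeAt zero (x ∷ xs) = xs
removeAt (suc i) (x ∷ xs) = x ∷ removeAt i xs

lookupL : ℕ → List ℕ → ℕ
lookupL i [] = zero
lookupL zero (x ∷ xs) = x
lookupL (suc i) (x ∷ xs) = lookupL i xs

updateL : ℕ → ℕ → List ℕ → List ℕ
updateL i v [] = []
updateL zero v (x ∷ xs) = v ∷ xs
updateL (suc i) v (x ∷ xs) = x ∷ updateL i v xs

-- Step (2): while v ∈ S, decrease v by one.
-- (The value 0 ∈ S case cannot occur for recurrent c; there we stop at 0.)
decWhile : List ℕ → ℕ → ℕ
decWhile S zero = zero
decWhile S (suc w) = if elem (suc w) S then decWhile S w else suc w

decStart : List ℕ → ℕ → ℕ
decStart S v = if elem v S then decWhile S v else v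

reduceStep : List ℕ → List ℕ
reduceStep c with firstRepeat c
... | nothing = c
... | just (i , j) =
  updateL i (decStart (removeAt i (take (suc j) c)) (lookupL i c)) c

-- Spots: list of length n, entry = car occupying it (if any).
Spots : Set
Spots = List (Maybe ℕ)

settle : ℕ → Spots → Maybe Spots
settle j [] = nothing
settle j (nothing ∷ xs) = just (just j ∷ xs)
settle j (just k ∷ xs) = Data.Maybe.map (just k ∷_) (settle j xs)

parkAt : ℕ → ℕ → Spots → Maybe Spots
parkAt s i [] = nothing
parkAt zero i (nothing ∷ xs) = just (just i ∷ xs)
parkAt zero i (just j ∷ xs) = Data.Maybe.map (just i ∷_) (settle j xs)
parkAt (suc s) i (x ∷ xs) = Data.Maybe.map (x ∷_) (parkAt s i xs)

-- car i with preference q ∈ [n] (1-based spot)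
parkCar : ℕ → ℕ → Spots → Maybe Spots
parkCar i zero sp = nothing
parkCar i (suc s) sp = parkAt s i sp

runMVP : ℕ → List ℕ → Spots → Maybe Spots
runMVP i [] sp = just sp
runMVP i (q ∷ qs) sp with parkCar i q sp
... | nothing = nothing
... | just sp' = runMVP (suc i) qs sp'

allParked : Spots → Maybe (List ℕ)
allParked [] = just []
allParked (nothing ∷ xs) = nothing
allParked (just k ∷ xs) = Data.Maybe.map (k ∷_) (allParked xs)

bindM : {A B : Set} → Maybe A → (A → Maybe B) → Maybe B
bindM nothing f = nothing
bindM (just a) f = f a

-- O_MVP_n(p): the list (π_1, …, π_n) with π_s the car (1-based) in spot s,
-- or nothing if some car fails to park.
outcomeMVP : (n : ℕ) → List ℕ → Maybe (List ℕ)
outcomeMVP n p = bindM (runMVP 1 p (replicate n nothing)) allParked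

-- Write c = as ++ x ∷ bs ++ x ∷ zs with as ++ x ∷ bs the longest repetition-free prefix;
-- the reduction step lowers the first x to the largest v < x missing from as ++ x ∷ bs.
-- An entry y is a preference for spot n − y, so the cars of as ++ x ∷ bs park directly at
-- their preferred spots, and the two runs differ only in that the car of the lowered entry
-- sits at the spot t of v instead of the spot s of x.  The car of the second x then arrives
-- at s; in the original run it bumps that car to the first free spot after s, which is t
-- because the spots of the values strictly between v and x are taken.  So both runs reach
-- the same state.  If the lowering stops at 0 without finding a gap, every spot from s on is
-- occupied and the original run fails, while the lowered list contains 0 twice and its run
-- fails as well.
module Submission where

open import Defs
open import Data.Nat using (ℕ; zero; suc; _+_; _∸_; _≤_; _<_; _≡ᵇ_; z≤n; s≤s)
open import Data.Nat.Properties
open import Data.Bool using (true; false; _∨_; T)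
open import Data.Bool.Properties using (∨-comm; ∨-assoc; ∨-identityʳ)
open import Data.List using (List; []; _∷_; _++_; length; map; take; replicate)
open import Data.List.Properties using (++-assoc; length-++; map-++; length-map; length-replicate)
open import Data.List.Membership.Propositional using (_∈_; _∉_)
open import Data.List.Membership.Propositional.Properties using (∈-++⁺ˡ; ∈-++⁺ʳ; ∈-++⁻; ∈-∃++; ∈-map⁺)
open import Data.List.Membership.DecPropositional _≟_ using (_∈?_)
open import Data.List.Relation.Unary.Any using (here; there)
open import Data.List.Relation.Unary.All as All using (All; []; _∷_)
import Data.List.Relation.Unary.All.Properties as Allₚ
open import Data.Maybe using (Maybe; just; nothing)
open import Data.Product using (_×_; _,_; ∃; ∃₂; proj₁; proj₂)
open import Data.Sum using (_⊎_; inj₁; inj₂)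
open import Data.Unit using (⊤; tt)
open import Data.Empty using (⊥-elim)
open import Data.Vec using (Vec; toList)
open import Function using (_∘_)
open import Relation.Nullary using (yes; no)
open import Relation.Binary.PropositionalEquality

private
  variable
    k m n u w x y : ℕ
    as bs xs : List ℕ

≡ᵇ≡true⇒≡ : (m ≡ᵇ n) ≡ true → m ≡ n
≡ᵇ≡true⇒≡ {m} {n} e = ≡ᵇ⇒≡ m n (subst T (sym e) tt)

≡ᵇ-refl : ∀ m → (m ≡ᵇ m) ≡ true
≡ᵇ-refl zero    = refl
≡ᵇ-refl (suc m) = ≡ᵇ-refl m

elem⇒∈ : ∀ xs → elem w xs ≡ true → w ∈ xs
elem⇒∈ {w} (x ∷ xs) e with w ≡ᵇ x in w≡ᵇx
... | true  = here (≡ᵇ≡true⇒≡ w≡ᵇx)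
... | false = there (elem⇒∈ xs e)

∈⇒elem : ∀ xs → w ∈ xs → elem w xs ≡ true
∈⇒elem {w} (x ∷ xs) (here refl) rewrite ≡ᵇ-refl w = refl
∈⇒elem {w} (x ∷ xs) (there w∈xs) rewrite ∈⇒elem xs w∈xs with w ≡ᵇ x
... | true  = refl
... | false = refl

elem≡false⇒∉ : ∀ xs → elem w xs ≡ false → w ∉ xs
elem≡false⇒∉ xs e w∈xs with trans (sym e) (∈⇒elem xs w∈xs)
... | ()

elem-++ : ∀ w xs ys → elem w (xs ++ ys) ≡ elem w xs ∨ elem w ys
elem-++ w []       ys = refl
elem-++ w (x ∷ xs) ys rewrite elem-++ w xs ys = sym (∨-assoc (w ≡ᵇ x) (elem w xs) (elem w ys))

Distinct : List ℕ → Set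
Distinct []       = ⊤
Distinct (x ∷ xs) = x ∉ xs × Distinct xs

Distinct-∷ʳ : ∀ xs → Distinct xs → x ∉ xs → Distinct (xs ++ x ∷ [])
Distinct-∷ʳ []       _             _   = (λ ()) , tt
Distinct-∷ʳ {x} (a ∷ as) (a∉as , d) x∉a∷as = a∉as++x , Distinct-∷ʳ as d (x∉a∷as ∘ there)
  where
  a∉as++x : a ∉ as ++ x ∷ []
  a∉as++x a∈ with ∈-++⁻ as a∈
  ... | inj₁ a∈as        = a∉as a∈as
  ... | inj₂ (here refl) = x∉a∷as (here refl)

Distinct-middle : ∀ as bs → Distinct (as ++ x ∷ bs) → x ∉ as × x ∉ bs
Distinct-middle []       bs (x∉bs , _) = (λ ()) , x∉bs
Distinct-middle {x} (a ∷ as) bs (a∉ , d) = x∉a∷as , proj₂ (Distinct-middle as bs d)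
  where
  x∉a∷as : x ∉ a ∷ as
  x∉a∷as (here refl) = a∉ (∈-++⁺ʳ as (here refl))
  x∉a∷as (there x∈as) = proj₁ (Distinct-middle as bs d) x∈as

Distinct-replace : ∀ as bs → Distinct (as ++ x ∷ bs) → y ∉ as ++ x ∷ bs → Distinct (as ++ y ∷ bs)
Distinct-replace []       bs (_ , d) y∉ = y∉ ∘ there , d
Distinct-replace {x} {y} (a ∷ as) bs (a∉ , d) y∉ = a∉as++y∷bs , Distinct-replace as bs d (y∉ ∘ there)
  where
  a∉as++y∷bs : a ∉ as ++ y ∷ bs
  a∉as++y∷bs a∈ with ∈-++⁻ as a∈
  ... | inj₁ a∈as          = a∉ (∈-++⁺ˡ a∈as)
  ... | inj₂ (here refl)   = y∉ (here refl)
  ... | inj₂ (there a∈bs)  = a∉ (∈-++⁺ʳ as (there a∈bs))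

Distinct-middle-∉ : ∀ as bs → Distinct (as ++ x ∷ bs) → x ∉ as ++ bs
Distinct-middle-∉ as bs distinct x∈ with ∈-++⁻ as x∈ | Distinct-middle as bs distinct
... | inj₁ x∈as | x∉as , _    = x∉as x∈as
... | inj₂ x∈bs | _    , x∉bs = x∉bs x∈bs

∈-++-insert : ∀ as bs → w ∈ as ++ bs → w ∈ as ++ x ∷ bs
∈-++-insert as bs w∈ with ∈-++⁻ as w∈
... | inj₁ w∈as = ∈-++⁺ˡ w∈as
... | inj₂ w∈bs = ∈-++⁺ʳ as (there w∈bs)

∈-++-remove : ∀ as bs → w ∈ as ++ x ∷ bs → w ≢ x → w ∈ as ++ bs
∈-++-remove as bs w∈ w≢x with ∈-++⁻ as w∈
... | inj₁ w∈as         = ∈-++⁺ˡ w∈as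
... | inj₂ (here refl)  = ⊥-elim (w≢x refl)
... | inj₂ (there w∈bs) = ∈-++⁺ʳ as w∈bs

findRep-split : ∀ seen xs {i j} → findRep seen k xs ≡ just (i , j) → Distinct seen → length seen ≡ k →
  ∃₂ λ ys x → ∃ λ zs → seen ++ xs ≡ ys ++ x ∷ zs × Distinct ys × x ∈ ys × i ≡ indexOf x ys × j ≡ length ys
findRep-split seen (x ∷ xs) e d ℓ with elem x seen in x∈?seen
findRep-split seen (x ∷ xs) refl d ℓ | true = seen , x , xs , refl , d , elem⇒∈ seen x∈?seen , refl , sym ℓ
findRep-split seen (x ∷ xs) e d ℓ | false
  with ys , y , zs , eq , rest ← findRep-split (seen ++ x ∷ []) xs e
         (Distinct-∷ʳ seen d (elem≡false⇒∉ seen x∈?seen))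
         (trans (length-++ seen) (trans (+-comm (length seen) 1) (cong suc ℓ)))
  = ys , y , zs , trans (sym (++-assoc seen (x ∷ []) xs)) eq , rest

indexOf-middle : ∀ as bs → x ∉ as → indexOf x (as ++ x ∷ bs) ≡ length as
indexOf-middle {x} []       bs _ rewrite ≡ᵇ-refl x = refl
indexOf-middle {x} (a ∷ as) bs x∉ with x ≡ᵇ a in x≡ᵇa
... | true  = ⊥-elim (x∉ (here (≡ᵇ≡true⇒≡ x≡ᵇa)))
... | false = cong suc (indexOf-middle as bs (x∉ ∘ there))

firstRepeat-split : ∀ c {i j} → firstRepeat c ≡ just (i , j) →
  ∃₂ λ as x → ∃₂ λ bs zs → c ≡ (as ++ x ∷ bs) ++ x ∷ zs × Distinct (as ++ x ∷ bs)
    × i ≡ length as × j ≡ length (as ++ x ∷ bs)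
firstRepeat-split c e
  with ys , x , zs , refl , d , x∈ys , refl , refl ← findRep-split [] c e tt refl
  with as , bs , refl ← ∈-∃++ x∈ys
  = as , x , bs , zs , refl , d
  , indexOf-middle as bs (proj₁ (Distinct-middle as bs d)) , refl

lookupL-length : ∀ as r → lookupL (length as) (as ++ x ∷ r) ≡ x
lookupL-length []       r = refl
lookupL-length (a ∷ as) r = lookupL-length as r

updateL-length : ∀ as r → updateL (length as) y (as ++ x ∷ r) ≡ as ++ y ∷ r
updateL-length []       r = refl
updateL-length (a ∷ as) r = cong (a ∷_) (updateL-length as r)

removeAt-length : ∀ as r → removeAt (length as) (as ++ x ∷ r) ≡ as ++ r
removeAt-length []       r = refl
removeAt-length (a ∷ as) r = cong (a ∷_) (removeAt-length as r)

take-suc-length : ∀ ys zs → take (suc (length ys)) (ys ++ x ∷ zs) ≡ ys ++ x ∷ []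
take-suc-length []       zs = refl
take-suc-length (y ∷ ys) zs = cong (y ∷_) (take-suc-length ys zs)

reduceStep-lowers-first-repeat : ∀ c → reduceStep c ≡ c ⊎
  ∃₂ λ as x → ∃₂ λ bs zs → c ≡ (as ++ x ∷ bs) ++ x ∷ zs × Distinct (as ++ x ∷ bs)
    × reduceStep c ≡ (as ++ decStart (as ++ bs ++ x ∷ []) x ∷ bs) ++ x ∷ zs
reduceStep-lowers-first-repeat c with firstRepeat c in e
... | nothing = inj₁ refl
... | just (i , j)
  with as , x , bs , zs , refl , d , refl , refl ← firstRepeat-split c e
  rewrite take-suc-length {x} (as ++ x ∷ bs) zs
        | ++-assoc as (x ∷ bs) (x ∷ [])
        | ++-assoc as (x ∷ bs) (x ∷ zs)
        | lookupL-length {x} as (bs ++ x ∷ zs)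
        | removeAt-length {x} as (bs ++ x ∷ [])
        | updateL-length {decStart (as ++ bs ++ x ∷ []) x} {x} as (bs ++ x ∷ zs)
  = inj₂ (as , x , bs , zs , sym (++-assoc as (x ∷ bs) (x ∷ zs)) , d , sym (++-assoc as _ (x ∷ zs)))

decWhile-cong : ∀ S T → (∀ w → elem w S ≡ elem w T) → ∀ u → decWhile S u ≡ decWhile T u
decWhile-cong S T same zero    = refl
decWhile-cong S T same (suc u) rewrite same (suc u) with elem (suc u) T
... | true  = decWhile-cong S T same u
... | false = refl

decWhile-≤ : ∀ S u → decWhile S u ≤ u
decWhile-≤ S zero    = z≤n
decWhile-≤ S (suc u) with elem (suc u) S
... | true  = m≤n⇒m≤1+n (decWhile-≤ S u)
... | false = ≤-refl

decWhile-skips : ∀ S u → decWhile S u < w → w ≤ u → w ∈ S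
decWhile-skips S zero    lt w≤0 = ⊥-elim (<⇒≱ lt (≤-trans w≤0 z≤n))
decWhile-skips S (suc u) lt w≤ with elem (suc u) S in su∈?S
... | false = ⊥-elim (<⇒≱ lt w≤)
... | true with m≤n⇒m<n∨m≡n w≤
...   | inj₂ refl      = elem⇒∈ S su∈?S
...   | inj₁ (s≤s w≤u) = decWhile-skips S u lt w≤u

decWhile-stops : ∀ S u → decWhile S u ∉ S ⊎ decWhile S u ≡ 0
decWhile-stops S zero    = inj₂ refl
decWhile-stops S (suc u) with elem (suc u) S in su∈?S
... | true  = decWhile-stops S u
... | false = inj₁ (elem≡false⇒∉ S su∈?S)

decStart-zero : ∀ S → decStart S 0 ≡ 0
decStart-zero S with elem 0 S
... | true  = refl
... | false = refl

decStart-suc : ∀ S → elem (suc w) S ≡ true → decStart S (suc w) ≡ decWhile S w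
decStart-suc S e rewrite e = refl

elem-move-last : ∀ u as bs → elem u (as ++ bs ++ x ∷ []) ≡ elem u (as ++ x ∷ bs)
elem-move-last {x} u as bs
  rewrite elem-++ u as (bs ++ x ∷ []) | elem-++ u as (x ∷ bs) | elem-++ u bs (x ∷ [])
        | ∨-identityʳ (u ≡ᵇ x) | ∨-comm (elem u bs) (u ≡ᵇ x) = refl

decStart-middle : ∀ as bs → decStart (as ++ bs ++ suc w ∷ []) (suc w) ≡ decWhile (as ++ suc w ∷ bs) w
decStart-middle {w} as bs = begin
  decStart (as ++ bs ++ suc w ∷ []) (suc w)
    ≡⟨ decStart-suc (as ++ bs ++ suc w ∷ []) (trans (elem-move-last (suc w) as bs) (∈⇒elem (as ++ suc w ∷ bs) (∈-++⁺ʳ as (here refl)))) ⟩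
  decWhile (as ++ bs ++ suc w ∷ []) w
    ≡⟨ decWhile-cong (as ++ bs ++ suc w ∷ []) (as ++ suc w ∷ bs) (λ u → elem-move-last u as bs) w ⟩
  decWhile (as ++ suc w ∷ bs) w ∎
  where open ≡-Reasoning

occupant : ℕ → Spots → Maybe ℕ
occupant u       []       = nothing
occupant zero    (o ∷ sp) = o
occupant (suc u) (o ∷ sp) = occupant u sp

assign : ℕ → Maybe ℕ → Spots → Spots
assign u       a []       = []
assign zero    a (o ∷ sp) = a ∷ sp
assign (suc u) a (o ∷ sp) = o ∷ assign u a sp

Occupied : ℕ → Spots → Set
Occupied u sp = occupant u sp ≢ nothing

empty : ℕ → Spots
empty n = replicate n nothing

length-assign : ∀ u a sp → length (assign u a sp) ≡ length sp
length-assign u       a []       = refl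
length-assign zero    a (o ∷ sp) = refl
length-assign (suc u) a (o ∷ sp) = cong suc (length-assign u a sp)

occupant-assign-≡ : ∀ u a sp → u < length sp → occupant u (assign u a sp) ≡ a
occupant-assign-≡ zero    a (o ∷ sp) _         = refl
occupant-assign-≡ (suc u) a (o ∷ sp) (s≤s u<) = occupant-assign-≡ u a sp u<

occupant-assign-≢ : ∀ s u a sp → s ≢ u → occupant u (assign s a sp) ≡ occupant u sp
occupant-assign-≢ s       u       a []       _   = refl
occupant-assign-≢ zero    zero    a (o ∷ sp) s≢u = ⊥-elim (s≢u refl)
occupant-assign-≢ zero    (suc u) a (o ∷ sp) _   = refl
occupant-assign-≢ (suc s) zero    a (o ∷ sp) _   = refl
occupant-assign-≢ (suc s) (suc u) a (o ∷ sp) s≢u = occupant-assign-≢ s u a sp (s≢u ∘ cong suc)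

Occupied-assign-just : ∀ s u k sp → Occupied u sp → Occupied u (assign s (just k) sp)
Occupied-assign-just s       u       k []       occ = occ
Occupied-assign-just zero    zero    k (o ∷ sp) occ = λ ()
Occupied-assign-just zero    (suc u) k (o ∷ sp) occ = occ
Occupied-assign-just (suc s) zero    k (o ∷ sp) occ = occ
Occupied-assign-just (suc s) (suc u) k (o ∷ sp) occ = Occupied-assign-just s u k sp occ

assign-idem : ∀ s a b sp → assign s a (assign s b sp) ≡ assign s a sp
assign-idem s       a b []       = refl
assign-idem zero    a b (o ∷ sp) = refl
assign-idem (suc s) a b (o ∷ sp) = cong (o ∷_) (assign-idem s a b sp)

assign-comm : ∀ s t a b sp → s ≢ t → assign s a (assign t b sp) ≡ assign t b (assign s a sp)
assign-comm s       t       a b []       _   = refl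
assign-comm zero    zero    a b (o ∷ sp) s≢t = ⊥-elim (s≢t refl)
assign-comm zero    (suc t) a b (o ∷ sp) _   = refl
assign-comm (suc s) zero    a b (o ∷ sp) _   = refl
assign-comm (suc s) (suc t) a b (o ∷ sp) s≢t = cong (o ∷_) (assign-comm s t a b sp (s≢t ∘ cong suc))

occupant-empty : ∀ u n → occupant u (empty n) ≡ nothing
occupant-empty u       zero    = refl
occupant-empty zero    (suc n) = refl
occupant-empty (suc u) (suc n) = occupant-empty u n

settle-free : ∀ k sp t → (∀ u → u < t → Occupied u sp) → occupant t sp ≡ nothing → t < length sp →
  settle k sp ≡ just (assign t (just k) sp)
settle-free k (nothing ∷ sp) zero    _   _ _ = refl
settle-free k (just j ∷ sp)  zero    _   () _
settle-free k (nothing ∷ sp) (suc t) occ _ _ = ⊥-elim (occ 0 (s≤s z≤n) refl)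
settle-free k (just j ∷ sp)  (suc t) occ free (s≤s t<)
  rewrite settle-free k sp t (λ u u<t → occ (suc u) (s≤s u<t)) free t< = refl

settle-full : ∀ k sp → (∀ u → u < length sp → Occupied u sp) → settle k sp ≡ nothing
settle-full k []             _   = refl
settle-full k (nothing ∷ sp) occ = ⊥-elim (occ 0 (s≤s z≤n) refl)
settle-full k (just j ∷ sp)  occ rewrite settle-full k sp (λ u u< → occ (suc u) (s≤s u<)) = refl

parkAt-free : ∀ s i sp → s < length sp → occupant s sp ≡ nothing → parkAt s i sp ≡ just (assign s (just i) sp)
parkAt-free zero    i (nothing ∷ sp) _        _  = refl
parkAt-free zero    i (just x ∷ sp)  _        ()
parkAt-free (suc s) i (o ∷ sp)       (s≤s s<) free rewrite parkAt-free s i sp s< free = refl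

parkAt-bump : ∀ s t i k sp → occupant s sp ≡ just k → (∀ u → s < u → u < t → Occupied u sp) →
  occupant t sp ≡ nothing → s < t → t < length sp →
  parkAt s i sp ≡ just (assign t (just k) (assign s (just i) sp))
parkAt-bump zero    (suc t) i k (just k ∷ sp) refl occ free _ (s≤s t<)
  rewrite settle-free k sp t (λ u u<t → occ (suc u) (s≤s z≤n) (s≤s u<t)) free t< = refl
parkAt-bump (suc s) (suc t) i k (o ∷ sp) s↦k occ free (s≤s s<t) (s≤s t<)
  rewrite parkAt-bump s t i k sp s↦k (λ u s<u u<t → occ (suc u) (s≤s s<u) (s≤s u<t)) free s<t t< = refl

parkAt-full : ∀ s i k sp → occupant s sp ≡ just k → (∀ u → s < u → u < length sp → Occupied u sp) →
  parkAt s i sp ≡ nothing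
parkAt-full zero    i k (just k ∷ sp) refl occ
  rewrite settle-full k sp (λ u u< → occ (suc u) (s≤s z≤n) (s≤s u<)) = refl
parkAt-full (suc s) i k (o ∷ sp) s↦k occ
  rewrite parkAt-full s i k sp s↦k (λ u s<u u< → occ (suc u) (s≤s s<u) (s≤s u<)) = refl

settle-monotone : ∀ k sp {sp′} → settle k sp ≡ just sp′ →
  length sp′ ≡ length sp × (∀ u → Occupied u sp → Occupied u sp′)
settle-monotone k (nothing ∷ sp) refl = refl , λ { zero _ → λ () ; (suc u) occ → occ }
settle-monotone k (just j ∷ sp) e with settle k sp in settled
settle-monotone k (just j ∷ sp) refl | just sp′
  with ℓ , mono ← settle-monotone k sp settled
  = cong suc ℓ , λ { zero occ → occ ; (suc u) occ → mono u occ }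

parkAt-monotone : ∀ s i sp {sp′} → parkAt s i sp ≡ just sp′ →
  length sp′ ≡ length sp × (∀ u → Occupied u sp → Occupied u sp′) × Occupied s sp′
parkAt-monotone zero i (nothing ∷ sp) refl = refl , (λ { zero _ → λ () ; (suc u) occ → occ }) , λ ()
parkAt-monotone zero i (just j ∷ sp) e with settle j sp in settled
parkAt-monotone zero i (just j ∷ sp) refl | just sp′
  with ℓ , mono ← settle-monotone j sp settled
  = cong suc ℓ , (λ { zero _ → λ () ; (suc u) occ → mono u occ }) , λ ()
parkAt-monotone (suc s) i (o ∷ sp) e with parkAt s i sp in parked
parkAt-monotone (suc s) i (o ∷ sp) refl | just sp′
  with ℓ , mono , occ-s ← parkAt-monotone s i sp parked
  = cong suc ℓ , (λ { zero occ → occ ; (suc u) occ → mono u occ }) , occ-s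

-- A car bumped from s to the first free spot t ends up as if it had preferred t.
parkAt-bump≡parkAt-direct : ∀ s t i k sp → s < t → t < length sp →
  occupant s sp ≡ nothing → occupant t sp ≡ nothing → (∀ u → s < u → u < t → Occupied u sp) →
  parkAt s i (assign s (just k) sp) ≡ parkAt s i (assign t (just k) sp)
parkAt-bump≡parkAt-direct s t i k sp s<t t<ℓ s-free t-free between = begin
  parkAt s i (assign s (just k) sp)
    ≡⟨ parkAt-bump s t i k (assign s (just k) sp)
         (occupant-assign-≡ s (just k) sp s<ℓ)
         (λ u s<u u<t → Occupied-assign-just s u k sp (between u s<u u<t))
         (trans (occupant-assign-≢ s t (just k) sp s≢t) t-free)
         s<t (subst (t <_) (sym (length-assign s (just k) sp)) t<ℓ) ⟩
  just (assign t (just k) (assign s (just i) (assign s (just k) sp)))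
    ≡⟨ cong (just ∘ assign t (just k)) (assign-idem s (just i) (just k) sp) ⟩
  just (assign t (just k) (assign s (just i) sp))
    ≡⟨ cong just (sym (assign-comm s t (just i) (just k) sp s≢t)) ⟩
  just (assign s (just i) (assign t (just k) sp))
    ≡⟨ sym (parkAt-free s i (assign t (just k) sp)
         (subst (s <_) (sym (length-assign t (just k) sp)) s<ℓ)
         (trans (occupant-assign-≢ t s (just k) sp (s≢t ∘ sym)) s-free)) ⟩
  parkAt s i (assign t (just k) sp) ∎
  where
  open ≡-Reasoning
  s<ℓ = <-trans s<t t<ℓ
  s≢t = <⇒≢ s<t

runMVP-∷ : ∀ k q qs sp → runMVP k (q ∷ qs) sp ≡ bindM (parkCar k q sp) (runMVP (suc k) qs)
runMVP-∷ k q qs sp with parkCar k q sp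
... | nothing = refl
... | just _  = refl

runMVP-++ : ∀ k ps qs sp → runMVP k (ps ++ qs) sp ≡ bindM (runMVP k ps sp) (runMVP (k + length ps) qs)
runMVP-++ k []       qs sp rewrite +-identityʳ k = refl
runMVP-++ k (p ∷ ps) qs sp with parkCar k p sp
... | nothing = refl
... | just sp′ rewrite +-suc k (length ps) = runMVP-++ (suc k) ps qs sp′

data Twice (a : ℕ) : List ℕ → Set where
  now   : ∀ {xs} → a ∈ xs → Twice a (a ∷ xs)
  later : ∀ {x xs} → Twice a xs → Twice a (x ∷ xs)

Twice-map : ∀ (f : ℕ → ℕ) xs → Twice x xs → Twice (f x) (map f xs)
Twice-map f (_ ∷ xs) (now x∈)     = now (∈-map⁺ f x∈)
Twice-map f (_ ∷ xs) (later twice) = later (Twice-map f xs twice)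

Twice-++⁺ˡ : ∀ xs ys → Twice x xs → Twice x (xs ++ ys)
Twice-++⁺ˡ (_ ∷ xs) ys (now x∈)      = now (∈-++⁺ˡ x∈)
Twice-++⁺ˡ (_ ∷ xs) ys (later twice) = later (Twice-++⁺ˡ xs ys twice)

Twice-++⁺ʳ : ∀ xs ys → Twice x ys → Twice x (xs ++ ys)
Twice-++⁺ʳ []       ys twice = twice
Twice-++⁺ʳ (_ ∷ xs) ys twice = later (Twice-++⁺ʳ xs ys twice)

Twice-∈-++ : ∀ xs ys → x ∈ xs → Twice x (xs ++ x ∷ ys)
Twice-∈-++ (_ ∷ xs) ys (here refl) = now (∈-++⁺ʳ xs (here refl))
Twice-∈-++ (_ ∷ xs) ys (there x∈)  = later (Twice-∈-++ xs ys x∈)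

runMVP-last-occupied : ∀ k qs sp → length sp ≡ suc m → Occupied m sp → suc m ∈ qs → runMVP k qs sp ≡ nothing
runMVP-last-occupied k (q ∷ qs) sp ℓ occ q∈ with parkCar k q sp in parked
... | nothing = refl
runMVP-last-occupied {m} k (q ∷ qs) sp ℓ occ (here refl) | just _ with occupant m sp in m↦
...   | nothing = ⊥-elim (occ refl)
...   | just j with trans (sym parked)
                   (parkAt-full m k j sp m↦ (λ u m<u u<ℓ → ⊥-elim (<⇒≱ m<u (≤-pred (subst (u <_) ℓ u<ℓ)))))
...     | ()
runMVP-last-occupied k (zero ∷ qs) sp ℓ occ (there q∈) | just _ with parked
... | ()
runMVP-last-occupied {m} k (suc s ∷ qs) sp ℓ occ (there q∈) | just sp′
  with ℓ′ , mono , _ ← parkAt-monotone s k sp parked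
  = runMVP-last-occupied (suc k) qs sp′ (trans ℓ′ ℓ) (mono m occ) q∈

runMVP-Twice-last : ∀ k qs sp → length sp ≡ suc m → Twice (suc m) qs → runMVP k qs sp ≡ nothing
runMVP-Twice-last k (q ∷ qs) sp ℓ twice with parkCar k q sp in parked
... | nothing = refl
runMVP-Twice-last {m} k (suc m ∷ qs) sp ℓ (now q∈) | just sp′
  with ℓ′ , _ , occ ← parkAt-monotone m k sp parked
  = runMVP-last-occupied (suc k) qs sp′ (trans ℓ′ ℓ) occ q∈
runMVP-Twice-last k (zero ∷ qs) sp ℓ (later twice) | just _ with parked
... | ()
runMVP-Twice-last k (suc s ∷ qs) sp ℓ (later twice) | just sp′
  with ℓ′ , _ , _ ← parkAt-monotone s k sp parked
  = runMVP-Twice-last (suc k) qs sp′ (trans ℓ′ ℓ) twice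

-- The entry x of a configuration is the preference n ∸ x, that is, the 0-based spot n ∸ suc x.

spotOf : ℕ → ℕ → ℕ
spotOf n x = n ∸ suc x

parkCar-value : ∀ k sp → x < n → parkCar k (n ∸ x) sp ≡ parkAt (spotOf n x) k sp
parkCar-value {x} {suc m} k sp x<n rewrite +-∸-assoc 1 (≤-pred x<n) = refl

spotOf-< : x < n → spotOf n x < n
spotOf-< {x} {suc m} _ = s≤s (m∸n≤m m x)

spotOf-injective : x < n → y < n → spotOf n x ≡ spotOf n y → x ≡ y
spotOf-injective x<n y<n e = suc-injective (∸-cancelˡ-≡ x<n y<n e)

spotOf-<-antitone : y < x → x < n → spotOf n x < spotOf n y
spotOf-<-antitone y<x x<n = ∸-monoʳ-< (s≤s y<x) x<n

spotOf-<-reflect : spotOf n x < spotOf n y → y < x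
spotOf-<-reflect {n} lt = ≤-pred (∸-cancelʳ-< {o = n} lt)

spotOf-surjective : u < n → ∃ λ w → w < n × spotOf n w ≡ u
spotOf-surjective {u} {suc m} (s≤s u≤m) = m ∸ u , s≤s (m∸n≤m m u) , m∸[m∸n]≡n u≤m

placeAll : ℕ → ℕ → List ℕ → Spots → Spots
placeAll n k []       sp = sp
placeAll n k (x ∷ xs) sp = placeAll n (suc k) xs (assign (spotOf n x) (just k) sp)

length-placeAll : ∀ n k xs sp → length (placeAll n k xs sp) ≡ length sp
length-placeAll n k []       sp = refl
length-placeAll n k (x ∷ xs) sp = trans (length-placeAll n (suc k) xs _) (length-assign (spotOf n x) _ sp)

placeAll-++ : ∀ n k as bs sp → placeAll n k (as ++ bs) sp ≡ placeAll n (k + length as) bs (placeAll n k as sp)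
placeAll-++ n k []       bs sp rewrite +-identityʳ k = refl
placeAll-++ n k (a ∷ as) bs sp rewrite +-suc k (length as) = placeAll-++ n (suc k) as bs _

occupant-placeAll-∉ : ∀ k xs sp → All (_< n) xs → y < n → y ∉ xs →
  occupant (spotOf n y) (placeAll n k xs sp) ≡ occupant (spotOf n y) sp
occupant-placeAll-∉ k []       sp _             _   _  = refl
occupant-placeAll-∉ {n} {y} k (x ∷ xs) sp (x<n ∷ xs<n) y<n y∉ =
  trans (occupant-placeAll-∉ (suc k) xs _ xs<n y<n (y∉ ∘ there))
        (occupant-assign-≢ (spotOf n x) (spotOf n y) _ sp
           (λ e → y∉ (here (spotOf-injective y<n x<n (sym e)))))

Occupied-placeAll : ∀ n k xs sp → Occupied u sp → Occupied u (placeAll n k xs sp)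
Occupied-placeAll n k []       sp occ = occ
Occupied-placeAll n k (x ∷ xs) sp occ =
  Occupied-placeAll n (suc k) xs _ (Occupied-assign-just (spotOf n x) _ k sp occ)

Occupied-placeAll-∈ : ∀ k xs sp → All (_< n) xs → length sp ≡ n → y ∈ xs → Occupied (spotOf n y) (placeAll n k xs sp)
Occupied-placeAll-∈ {n} k (x ∷ xs) sp (x<n ∷ _) ℓ (here refl) =
  Occupied-placeAll n (suc k) xs _ λ e →
    just≢nothing (trans (sym (occupant-assign-≡ (spotOf n x) (just k) sp (subst (spotOf n x <_) (sym ℓ) (spotOf-< x<n)))) e)
  where
  just≢nothing : just k ≢ nothing
  just≢nothing ()
Occupied-placeAll-∈ k (x ∷ xs) sp (_ ∷ xs<n) ℓ (there y∈) =
  Occupied-placeAll-∈ (suc k) xs _ xs<n (trans (length-assign _ _ sp) ℓ) y∈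

placeAll-assign-comm : ∀ k xs a sp → All (_< n) xs → x < n → x ∉ xs →
  placeAll n k xs (assign (spotOf n x) a sp) ≡ assign (spotOf n x) a (placeAll n k xs sp)
placeAll-assign-comm k []       a sp _            _   _  = refl
placeAll-assign-comm {n} {x} k (y ∷ xs) a sp (y<n ∷ xs<n) x<n x∉ =
  trans (cong (placeAll n (suc k) xs)
           (assign-comm (spotOf n y) (spotOf n x) (just k) a sp
              (λ e → x∉ (here (spotOf-injective x<n y<n (sym e))))))
        (placeAll-assign-comm (suc k) xs a _ xs<n x<n (x∉ ∘ there))

placeAll-middle : ∀ k as bs sp → All (_< n) bs → x < n → x ∉ bs →
  placeAll n k (as ++ x ∷ bs) sp
    ≡ assign (spotOf n x) (just (k + length as)) (placeAll n (suc (k + length as)) bs (placeAll n k as sp))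
placeAll-middle k as bs sp bs<n x<n x∉bs =
  trans (placeAll-++ _ k as (_ ∷ bs) sp) (placeAll-assign-comm _ bs _ _ bs<n x<n x∉bs)

runMVP-distinct : ∀ k xs sp → Distinct xs → All (_< n) xs →
  (∀ {y} → y ∈ xs → occupant (spotOf n y) sp ≡ nothing) → length sp ≡ n →
  runMVP k (map (n ∸_) xs) sp ≡ just (placeAll n k xs sp)
runMVP-distinct k []       sp _ _ _ _ = refl
runMVP-distinct {n} k (x ∷ xs) sp (x∉ , distinct) (x<n ∷ xs<n) free ℓ
  rewrite parkCar-value k sp x<n
        | parkAt-free (spotOf n x) k sp (subst (spotOf n x <_) (sym ℓ) (spotOf-< x<n)) (free (here refl))
  = runMVP-distinct (suc k) xs _ distinct xs<n free′ (trans (length-assign _ _ sp) ℓ)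
  where
  free′ : ∀ {y} → y ∈ xs → occupant (spotOf n y) (assign (spotOf n x) (just k) sp) ≡ nothing
  free′ {y} y∈ = trans (occupant-assign-≢ (spotOf n x) (spotOf n y) _ sp
                          (λ e → x∉ (subst (_∈ xs) (spotOf-injective (All.lookup xs<n y∈) x<n (sym e)) y∈)))
                       (free (there y∈))

-- The spots after the distinct cars of as ++ y ∷ bs have parked, without the car of y.
occupiedBy : ℕ → List ℕ → List ℕ → Spots
occupiedBy n as bs = placeAll n (suc (suc (length as))) bs (placeAll n 1 as (empty n))

length-occupiedBy : ∀ n as bs → length (occupiedBy n as bs) ≡ n
length-occupiedBy n as bs =
  trans (length-placeAll n _ bs _) (trans (length-placeAll n 1 as _) (length-replicate n))

occupant-occupiedBy-∉ : ∀ as bs → All (_< n) (as ++ bs) → y < n → y ∉ as ++ bs →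
  occupant (spotOf n y) (occupiedBy n as bs) ≡ nothing
occupant-occupiedBy-∉ {n} {y} as bs bounded y<n y∉ =
  trans (occupant-placeAll-∉ _ bs _ (Allₚ.++⁻ʳ as bounded) y<n (y∉ ∘ ∈-++⁺ʳ as))
    (trans (occupant-placeAll-∉ 1 as _ (Allₚ.++⁻ˡ as bounded) y<n (y∉ ∘ ∈-++⁺ˡ))
      (occupant-empty (spotOf n y) n))

Occupied-occupiedBy-∈ : ∀ as bs → All (_< n) (as ++ bs) → y ∈ as ++ bs → Occupied (spotOf n y) (occupiedBy n as bs)
Occupied-occupiedBy-∈ {n} as bs bounded y∈ with ∈-++⁻ as y∈
... | inj₁ y∈as = Occupied-placeAll n _ bs _
                    (Occupied-placeAll-∈ 1 as _ (Allₚ.++⁻ˡ as bounded) (length-replicate n) y∈as)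
... | inj₂ y∈bs = Occupied-placeAll-∈ _ bs _ (Allₚ.++⁻ʳ as bounded)
                    (trans (length-placeAll n 1 as _) (length-replicate n)) y∈bs

runMVP-repeat : ∀ n as y bs x zs → Distinct (as ++ y ∷ bs) → All (_< n) (as ++ y ∷ bs) → x < n →
  runMVP 1 (map (n ∸_) ((as ++ y ∷ bs) ++ x ∷ zs)) (empty n)
    ≡ bindM (parkAt (spotOf n x) (suc (length as + suc (length bs)))
                    (assign (spotOf n y) (just (suc (length as))) (occupiedBy n as bs)))
            (runMVP (suc (suc (length as + suc (length bs)))) (map (n ∸_) zs))
runMVP-repeat n as y bs x zs distinct bounded x<n = begin
  runMVP 1 (map f (ys ++ x ∷ zs)) (empty n)
    ≡⟨ cong (λ qs → runMVP 1 qs (empty n)) (map-++ f ys (x ∷ zs)) ⟩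
  runMVP 1 (map f ys ++ map f (x ∷ zs)) (empty n)
    ≡⟨ runMVP-++ 1 (map f ys) (map f (x ∷ zs)) (empty n) ⟩
  bindM (runMVP 1 (map f ys) (empty n)) (runMVP (suc (length (map f ys))) (map f (x ∷ zs)))
    ≡⟨ cong (λ r → bindM r (runMVP (suc (length (map f ys))) (map f (x ∷ zs))))
            (runMVP-distinct 1 ys (empty n) distinct bounded (λ {y} _ → occupant-empty (spotOf n y) n)
              (length-replicate n)) ⟩
  runMVP (suc (length (map f ys))) (map f (x ∷ zs)) (placeAll n 1 ys (empty n))
    ≡⟨ cong₂ (λ j sp → runMVP (suc j) (map f (x ∷ zs)) sp)
         (trans (length-map f ys) (length-++ as))
         (placeAll-middle 1 as bs (empty n) (All.tail (Allₚ.++⁻ʳ as bounded)) (All.head (Allₚ.++⁻ʳ as bounded))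
           (proj₂ (Distinct-middle as bs distinct))) ⟩
  runMVP j (f x ∷ map f zs) (assign (spotOf n y) (just (suc (length as))) (occupiedBy n as bs))
    ≡⟨ runMVP-∷ j (f x) (map f zs) _ ⟩
  bindM (parkCar j (f x) (assign (spotOf n y) (just (suc (length as))) (occupiedBy n as bs))) (runMVP (suc j) (map f zs))
    ≡⟨ cong (λ r → bindM r (runMVP (suc j) (map f zs))) (parkCar-value j _ x<n) ⟩
  bindM (parkAt (spotOf n x) j (assign (spotOf n y) (just (suc (length as))) (occupiedBy n as bs)))
        (runMVP (suc j) (map f zs)) ∎
  where
  open ≡-Reasoning
  f = n ∸_
  ys = as ++ y ∷ bs
  j = suc (length as + suc (length bs))

runMVP-lower-to-gap : ∀ n as bs x v zs → Distinct (as ++ x ∷ bs) → All (_< n) ((as ++ x ∷ bs) ++ x ∷ zs) →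
  v < x → v ∉ as ++ x ∷ bs → (∀ w → v < w → w < x → w ∈ as ++ bs) →
  runMVP 1 (map (n ∸_) ((as ++ v ∷ bs) ++ x ∷ zs)) (empty n) ≡ runMVP 1 (map (n ∸_) ((as ++ x ∷ bs) ++ x ∷ zs)) (empty n)
runMVP-lower-to-gap n as bs x v zs distinct bounded v<x v∉ gap = begin
  runMVP 1 (map (n ∸_) ((as ++ v ∷ bs) ++ x ∷ zs)) (empty n)
    ≡⟨ runMVP-repeat n as v bs x zs (Distinct-replace as bs distinct v∉) (Allₚ.++⁺ as<n (v<n ∷ bs<n)) x<n ⟩
  bindM (parkAt s j (assign t (just ci) Q)) rest
    ≡⟨ cong (λ r → bindM r rest) (sym (parkAt-bump≡parkAt-direct s t j ci Q s<t t<ℓ s-free t-free between)) ⟩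
  bindM (parkAt s j (assign s (just ci) Q)) rest
    ≡⟨ sym (runMVP-repeat n as x bs x zs distinct ys<n x<n) ⟩
  runMVP 1 (map (n ∸_) ((as ++ x ∷ bs) ++ x ∷ zs)) (empty n) ∎
  where
  open ≡-Reasoning
  ys<n = Allₚ.++⁻ˡ (as ++ x ∷ bs) bounded
  x<n = All.head (Allₚ.++⁻ʳ (as ++ x ∷ bs) bounded)
  v<n = <-trans v<x x<n
  as<n = Allₚ.++⁻ˡ as ys<n
  bs<n = All.tail (Allₚ.++⁻ʳ as ys<n)
  as++bs<n = Allₚ.++⁺ as<n bs<n
  s = spotOf n x
  t = spotOf n v
  j = suc (length as + suc (length bs))
  ci = suc (length as)
  Q = occupiedBy n as bs
  rest = runMVP (suc j) (map (n ∸_) zs)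
  s<t : s < t
  s<t = spotOf-<-antitone v<x x<n
  t<ℓ : t < length Q
  t<ℓ = subst (t <_) (sym (length-occupiedBy n as bs)) (spotOf-< v<n)
  s-free : occupant s Q ≡ nothing
  s-free = occupant-occupiedBy-∉ as bs as++bs<n x<n (Distinct-middle-∉ as bs distinct)
  t-free : occupant t Q ≡ nothing
  t-free = occupant-occupiedBy-∉ as bs as++bs<n v<n (v∉ ∘ ∈-++-insert as bs)
  between : ∀ u → s < u → u < t → Occupied u Q
  between u s<u u<t with w , _ , refl ← spotOf-surjective (<-trans u<t (spotOf-< v<n)) =
    Occupied-occupiedBy-∈ as bs as++bs<n (gap w (spotOf-<-reflect {n = n} u<t) (spotOf-<-reflect {n = n} s<u))

runMVP-repeated-zero : ∀ n as bs zs → 0 < n → 0 ∈ as ++ bs →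
  runMVP 1 (map (n ∸_) ((as ++ 0 ∷ bs) ++ zs)) (empty n) ≡ nothing
runMVP-repeated-zero (suc m) as bs zs _ 0∈ =
  runMVP-Twice-last 1 _ (empty (suc m)) (length-replicate (suc m)) (Twice-map (suc m ∸_) _ twice)
  where
  twice : Twice 0 ((as ++ 0 ∷ bs) ++ zs)
  twice with ∈-++⁻ as 0∈
  ... | inj₁ 0∈as = Twice-++⁺ˡ _ zs (Twice-∈-++ as bs 0∈as)
  ... | inj₂ 0∈bs = Twice-++⁺ˡ _ zs (Twice-++⁺ʳ as _ (now 0∈bs))

runMVP-no-gap : ∀ n as bs x zs → Distinct (as ++ x ∷ bs) → All (_< n) ((as ++ x ∷ bs) ++ x ∷ zs) →
  (∀ w → w < x → w ∈ as ++ bs) → runMVP 1 (map (n ∸_) ((as ++ x ∷ bs) ++ x ∷ zs)) (empty n) ≡ nothing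
runMVP-no-gap n as bs x zs distinct bounded below =
  trans (runMVP-repeat n as x bs x zs distinct ys<n x<n)
        (cong (λ r → bindM r (runMVP _ (map (n ∸_) zs)))
              (parkAt-full s _ ci F (occupant-assign-≡ s (just ci) Q s<ℓ) after))
  where
  ys<n = Allₚ.++⁻ˡ (as ++ x ∷ bs) bounded
  x<n = All.head (Allₚ.++⁻ʳ (as ++ x ∷ bs) bounded)
  as++bs<n = Allₚ.++⁺ (Allₚ.++⁻ˡ as ys<n) (All.tail (Allₚ.++⁻ʳ as ys<n))
  s = spotOf n x
  ci = suc (length as)
  Q = occupiedBy n as bs
  F = assign s (just ci) Q
  s<ℓ : s < length Q
  s<ℓ = subst (s <_) (sym (length-occupiedBy n as bs)) (spotOf-< x<n)
  after : ∀ u → s < u → u < length F → Occupied u F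
  after u s<u u<ℓ
    with w , _ , refl ← spotOf-surjective (subst (u <_) (trans (length-assign s _ Q) (length-occupiedBy n as bs)) u<ℓ)
    = Occupied-assign-just s _ ci Q (Occupied-occupiedBy-∈ as bs as++bs<n (below w (spotOf-<-reflect {n = n} s<u)))

runMVP-lower : ∀ n as bs x v zs → Distinct (as ++ x ∷ bs) → All (_< n) ((as ++ x ∷ bs) ++ x ∷ zs) →
  v < x → (∀ w → v < w → w < x → w ∈ as ++ bs) → v ∉ as ++ x ∷ bs ⊎ v ≡ 0 →
  runMVP 1 (map (n ∸_) ((as ++ v ∷ bs) ++ x ∷ zs)) (empty n) ≡ runMVP 1 (map (n ∸_) ((as ++ x ∷ bs) ++ x ∷ zs)) (empty n)
runMVP-lower n as bs x v zs distinct bounded v<x gap stopped with v ∈? as ++ x ∷ bs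
... | no v∉ = runMVP-lower-to-gap n as bs x v zs distinct bounded v<x v∉ gap
... | yes v∈ with stopped
...   | inj₁ v∉    = ⊥-elim (v∉ v∈)
...   | inj₂ refl =
  trans (runMVP-repeated-zero n as bs (x ∷ zs) (m<n⇒0<n x<n) 0∈as++bs)
        (sym (runMVP-no-gap n as bs x zs distinct bounded below))
  where
  x<n = All.head (Allₚ.++⁻ʳ (as ++ x ∷ bs) bounded)
  0∈as++bs = ∈-++-remove as bs v∈ (<⇒≢ v<x)
  below : ∀ w → w < x → w ∈ as ++ bs
  below zero    _   = 0∈as++bs
  below (suc w) w<x = gap (suc w) (s≤s z≤n) w<x

outcomeMVP-lower-first-repeat : ∀ n as x bs zs → Distinct (as ++ x ∷ bs) → All (_< n) ((as ++ x ∷ bs) ++ x ∷ zs) →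
  outcomeMVP n (toPref n ((as ++ decStart (as ++ bs ++ x ∷ []) x ∷ bs) ++ x ∷ zs))
    ≡ outcomeMVP n (toPref n ((as ++ x ∷ bs) ++ x ∷ zs))
outcomeMVP-lower-first-repeat n as zero bs zs _ _ rewrite decStart-zero (as ++ bs ++ 0 ∷ []) = refl
outcomeMVP-lower-first-repeat n as (suc w) bs zs distinct bounded rewrite decStart-middle {w} as bs =
  cong (λ r → bindM r allParked)
    (runMVP-lower n as bs (suc w) (decWhile ys w) zs distinct bounded
       (s≤s (decWhile-≤ ys w)) gap (decWhile-stops ys w))
  where
  ys = as ++ suc w ∷ bs
  gap : ∀ u → decWhile ys w < u → u < suc w → u ∈ as ++ bs
  gap u lowered<u u<x = ∈-++-remove as bs (decWhile-skips ys w lowered<u (≤-pred u<x)) (<⇒≢ u<x)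

reduceStep-preserves-outcome : ∀ n c → All (_< n) c → outcomeMVP n (toPref n (reduceStep c)) ≡ outcomeMVP n (toPref n c)
reduceStep-preserves-outcome n c bounded with reduceStep-lowers-first-repeat c
... | inj₁ unchanged = cong (outcomeMVP n ∘ toPref n) unchanged
... | inj₂ (as , x , bs , zs , refl , distinct , lowered) =
  trans (cong (outcomeMVP n ∘ toPref n) lowered) (outcomeMVP-lower-first-repeat n as x bs zs distinct bounded)

lemma5p10 : (n : ℕ) (c : Vec ℕ n) → Rec n c →
    outcomeMVP n (toPref n (reduceStep (toList c))) ≡ outcomeMVP n (toPref n (toList c))
lemma5p10 n c (stable , _) = reduceStep-preserves-outcome n (toList c) stable
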